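{- Let $n>1$ be an integer and let $S'=\{d\in\mathbb N: d=\gcd(\gcd(a-1,b-1),n)$ for some elements $a,b\in\mathbb Z_n$ incomparable with respect to $\leq\}$. Then $(\mathbb Z_n,\leq)$ is a lattice if and only if for every $d\in S'$ the ideal $(n/d)$ has a largest element with respect to $\leq$.
   Context: On $\mathbb Z_n$ define the partial order $\leq$ by: $a\leq b$ iff $a=b$ or $a\equiv ab\pmod n$. For $x\in\mathbb Z_n$, $(x)$ denotes the ideal of $\mathbb Z_n$ generated by $x$. -}

module Defs where

open import Data.Nat using (ℕ; zero; suc; _*_; _%_)
open import Data.Fin using (Fin; toℕ)
open import Data.Integer using (ℤ; +_; _-_)
open import Data.Integer.GCD using (gcd)
open import Data.Product using (Σ; ∃; _×_; _,_)
open import Data.Sum using (_⊎_)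
open import Relation.Binary.PropositionalEquality using (_≡_)
open import Relation.Nullary using (¬_)

-- reduction modulo n (for n = 0 it is the identity; only used with n > 1)
modN : ℕ → ℕ → ℕ
modN zero    x = x
modN (suc m) x = x % suc m

_≼⟨_⟩_ : {n : ℕ} → Fin n → ℕ → Fin n → Set
_≼⟨_⟩_ a n b = (a ≡ b) ⊎ (toℕ a ≡ modN n (toℕ a * toℕ b))

Leq : (n : ℕ) → Fin n → Fin n → Set
Leq n a b = a ≼⟨ n ⟩ b

Incomparable : (n : ℕ) → Fin n → Fin n → Set
Incomparable n a b = ¬ Leq n a b × ¬ Leq n b a

IsJoin : (n : ℕ) → Fin n → Fin n → Fin n → Set
IsJoin n a b j = (Leq n a j × Leq n b j)
               × (∀ u → Leq n a u → Leq n b u → Leq n j u)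

IsMeet : (n : ℕ) → Fin n → Fin n → Fin n → Set
IsMeet n a b m = (Leq n m a × Leq n m b)
               × (∀ l → Leq n l a → Leq n l b → Leq n l m)

IsLattice : ℕ → Set
IsLattice n = ∀ (a b : Fin n) → (∃ λ j → IsJoin n a b j) × (∃ λ m → IsMeet n a b m)

InIdeal : (n : ℕ) → ℕ → Fin n → Set
InIdeal n x y = ∃ λ (r : ℕ) → toℕ y ≡ modN n (x * r)

HasLargest : (n : ℕ) → ℕ → Set
HasLargest n x = ∃ λ (m : Fin n) → InIdeal n x m × (∀ y → InIdeal n x y → Leq n y m)

InS' : (n : ℕ) → ℕ → Set
InS' n d = ∃ λ (a : Fin n) → ∃ λ (b : Fin n) →
  Incomparable n a b × (+ d ≡ gcd (gcd (+ toℕ a - + 1) (+ toℕ b - + 1)) (+ n))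

-- Apart from the trivial case x = a, x ≤ a in ℤ_n means x ≡ x·a (mod n), i.e. n ∣ x·(a − 1).
-- A common lower bound y of two incomparable elements a, b is distinct from both, so
-- n ∣ y·gcd(a − 1, b − 1, n) = y·d, i.e. n/d ∣ y; conversely every multiple of n/d lies below
-- a and b.  Hence the common lower bounds of an incomparable pair are exactly the ideal
-- (n/d), and a meet of the pair is precisely a largest element of that ideal.  Comparable
-- pairs always have a meet, and since 1 is a top element of the finite poset ℤ_n, having
-- all meets already gives all joins.
module Submission where

open import Defs
open import Data.Nat using (ℕ; _<_; _*_)
open import Data.Product using (_×_)
open import Relation.Binary.PropositionalEquality using (_≡_)

open import Level using (Level)
open import Data.Nat as ℕ using (zero; suc; _+_; _%_; _/_; NonZero; s≤s)
open import Data.Nat.Properties using (*-zeroʳ; *-identityʳ; *-suc; *-comm; *-assoc; +-cancelˡ-≡; 0≢1+n)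
open import Data.Nat.DivMod
open import Data.Nat.Divisibility
open import Data.Nat.GCD using (gcd; gcd-greatest; gcd[m,n]∣m; gcd[m,n]∣n; c*gcd[m,n]≡gcd[cm,cn])
open import Data.Integer as ℤ using (+_)
open import Data.Fin as Fin using (Fin; toℕ)
open import Data.Fin.Properties using (toℕ<n)
open import Data.Product using (∃; _,_; proj₂; uncurry)
open import Data.Sum using (inj₁; inj₂)
open import Data.Empty using (⊥-elim)
open import Data.List using (List; []; _∷_; allFin)
open import Data.List.Membership.Propositional using (_∈_)
open import Data.List.Membership.Propositional.Properties using (∈-allFin)
open import Data.List.Relation.Unary.Any using (here; there)
open import Function.Bundles using (_⇔_; mk⇔; Equivalence)
open import Relation.Binary.Core using (Rel)
open import Relation.Binary.Definitions using (Transitive; Decidable)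
open import Relation.Nullary using (yes; no)
open import Relation.Nullary.Decidable using (_⊎-dec_; _×-dec_)
open import Relation.Binary.PropositionalEquality using (_≢_; refl; sym; trans; cong; subst; module ≡-Reasoning)

∣_-1∣ : ℕ → ℕ
∣ x -1∣ = ℤ.∣ + x ℤ.- + 1 ∣

∣*m∣*n⇒∣*gcd : ∀ {c} y m n → c ∣ y * m → c ∣ y * n → c ∣ y * gcd m n
∣*m∣*n⇒∣*gcd {c} y m n c∣ym c∣yn =
  subst (c ∣_) (sym (c*gcd[m,n]≡gcd[cm,cn] y m n)) (gcd-greatest c∣ym c∣yn)

module _ {n : ℕ} .{{_ : NonZero n}} where

  [m%n*o]%n≡[m*o]%n : ∀ m o → (m % n * o) % n ≡ (m * o) % n
  [m%n*o]%n≡[m*o]%n m o = begin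
    (m % n * o) % n           ≡⟨ %-distribˡ-* (m % n) o n ⟩
    (m % n % n * (o % n)) % n ≡⟨ cong (λ t → (t * (o % n)) % n) (m%n%n≡m%n m n) ⟩
    (m % n * (o % n)) % n     ≡⟨ %-distribˡ-* m o n ⟨
    (m * o) % n               ∎
    where open ≡-Reasoning

  [m*[o%n]]%n≡[m*o]%n : ∀ m o → (m * (o % n)) % n ≡ (m * o) % n
  [m*[o%n]]%n≡[m*o]%n m o = begin
    (m * (o % n)) % n ≡⟨ cong (_% n) (*-comm m (o % n)) ⟩
    (o % n * m) % n   ≡⟨ [m%n*o]%n≡[m*o]%n o m ⟩
    (o * m) % n       ≡⟨ cong (_% n) (*-comm o m) ⟩
    (m * o) % n       ∎
    where open ≡-Reasoning

  y≡[y+t]%n⇔n∣t : ∀ {y} t → y < n → (y ≡ (y + t) % n) ⇔ (n ∣ t)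
  y≡[y+t]%n⇔n∣t {y} t y<n = mk⇔ to from
    where
    to : y ≡ (y + t) % n → n ∣ t
    to y≡ = divides ((y + t) / n) (+-cancelˡ-≡ y t _ (begin
      y + t                         ≡⟨ m≡m%n+[m/n]*n (y + t) n ⟩
      (y + t) % n + (y + t) / n * n ≡⟨ cong (_+ (y + t) / n * n) y≡ ⟨
      y + (y + t) / n * n           ∎))
      where open ≡-Reasoning
    from : n ∣ t → y ≡ (y + t) % n
    from n∣t = sym (trans (%-remove-+ʳ y n∣t) (m<n⇒m%n≡m y<n))

  y≡[y*a]%n⇔n∣y*∣a-1∣ : ∀ {y} a → y < n → (y ≡ (y * a) % n) ⇔ (n ∣ y * ∣ a -1∣)
  y≡[y*a]%n⇔n∣y*∣a-1∣ {y} (suc a) y<n rewrite *-suc y a = y≡[y+t]%n⇔n∣t (y * a) y<n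
  y≡[y*a]%n⇔n∣y*∣a-1∣ {y} zero    y<n rewrite *-zeroʳ y | *-identityʳ y = mk⇔ to from
    where
    to : y ≡ 0 % n → n ∣ y
    to y≡0%n = subst (n ∣_) (sym (trans y≡0%n (n∣m⇒m%n≡0 0 n (n ∣0)))) (n ∣0)
    from : n ∣ y → y ≡ 0 % n
    from n∣y = begin
      y     ≡⟨ m<n⇒m%n≡m y<n ⟨
      y % n ≡⟨ n∣m⇒m%n≡0 y n n∣y ⟩
      0     ≡⟨ n∣m⇒m%n≡0 0 n (n ∣0) ⟨
      0 % n ∎
      where open ≡-Reasoning

module FiniteJoins {N : ℕ} {ℓ : Level} (_≤_ : Rel (Fin N) ℓ) (≤-trans : Transitive _≤_)
                   (_≤?_ : Decidable _≤_) (⊤ : Fin N) (≤-⊤ : ∀ x → x ≤ ⊤)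
                   (meet : ∀ a b → ∃ λ m → (m ≤ a × m ≤ b) × (∀ l → l ≤ a → l ≤ b → l ≤ m))
                   (a b : Fin N) where

  meetOfUpperBoundsIn : (xs : List (Fin N)) → ∃ λ j → (a ≤ j × b ≤ j)
                        × (∀ u → u ∈ xs → a ≤ u → b ≤ u → j ≤ u)
  meetOfUpperBoundsIn [] = ⊤ , (≤-⊤ a , ≤-⊤ b) , λ _ ()
  meetOfUpperBoundsIn (x ∷ xs) with meetOfUpperBoundsIn xs | (a ≤? x) ×-dec (b ≤? x)
  ... | j , (a≤j , b≤j) , j≤ | no ¬a≤x×b≤x = j , (a≤j , b≤j) , least
    where
    least : ∀ u → u ∈ x ∷ xs → a ≤ u → b ≤ u → j ≤ u
    least u (here refl) a≤u b≤u = ⊥-elim (¬a≤x×b≤x (a≤u , b≤u))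
    least u (there u∈xs) a≤u b≤u = j≤ u u∈xs a≤u b≤u
  ... | j , (a≤j , b≤j) , j≤ | yes (a≤x , b≤x) with meet j x
  ...   | m , (m≤j , m≤x) , glb = m , (glb a a≤j a≤x , glb b b≤j b≤x) , least
    where
    least : ∀ u → u ∈ x ∷ xs → a ≤ u → b ≤ u → m ≤ u
    least u (here refl) _ _ = m≤x
    least u (there u∈xs) a≤u b≤u = ≤-trans m≤j (j≤ u u∈xs a≤u b≤u)

  join : ∃ λ j → (a ≤ j × b ≤ j) × (∀ u → a ≤ u → b ≤ u → j ≤ u)
  join with meetOfUpperBoundsIn (allFin N)
  ... | j , ub , least = j , ub , λ u → least u (∈-allFin u)

module Order (m : ℕ) where

  n : ℕ
  n = suc m

  ≼-trans : Transitive (Leq n)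
  ≼-trans (inj₁ refl) z≼w = z≼w
  ≼-trans (inj₂ y≡yz) (inj₁ refl) = inj₂ y≡yz
  ≼-trans {y} {z} {w} (inj₂ y≡yz) (inj₂ z≡zw) = inj₂ (begin
    Y                     ≡⟨ y≡yz ⟩
    (Y * Z) % n           ≡⟨ cong (λ t → (Y * t) % n) z≡zw ⟩
    (Y * (Z * W % n)) % n ≡⟨ [m*[o%n]]%n≡[m*o]%n Y (Z * W) ⟩
    (Y * (Z * W)) % n     ≡⟨ cong (_% n) (*-assoc Y Z W) ⟨
    (Y * Z * W) % n       ≡⟨ [m%n*o]%n≡[m*o]%n (Y * Z) W ⟨
    (Y * Z % n * W) % n   ≡⟨ cong (λ t → (t * W) % n) y≡yz ⟨
    (Y * W) % n           ∎)
    where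
    open ≡-Reasoning
    Y = toℕ y
    Z = toℕ z
    W = toℕ w

  _≼?_ : Decidable (Leq n)
  y ≼? a = (y Fin.≟ a) ⊎-dec (toℕ y ℕ.≟ (toℕ y * toℕ a) % n)

  ≼⇒∣ : ∀ {y a} → Leq n y a → y ≢ a → n ∣ toℕ y * ∣ toℕ a -1∣
  ≼⇒∣ (inj₁ y≡a) y≢a = ⊥-elim (y≢a y≡a)
  ≼⇒∣ {y} {a} (inj₂ y≡ya) _ = Equivalence.to (y≡[y*a]%n⇔n∣y*∣a-1∣ (toℕ a) (toℕ<n y)) y≡ya

  ∣⇒≼ : ∀ {y a} → n ∣ toℕ y * ∣ toℕ a -1∣ → Leq n y a
  ∣⇒≼ {y} {a} n∣ = inj₂ (Equivalence.from (y≡[y*a]%n⇔n∣y*∣a-1∣ (toℕ a) (toℕ<n y)) n∣)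

  ∈ideal⇔∣ : ∀ {q y} → q ∣ n → InIdeal n q y ⇔ (q ∣ toℕ y)
  ∈ideal⇔∣ {q} {y} q∣n = mk⇔ to from
    where
    to : InIdeal n q y → q ∣ toℕ y
    to (r , y≡qr%n) = subst (q ∣_) (sym y≡qr%n) (%-presˡ-∣ (m∣m*n r) q∣n)
    from : q ∣ toℕ y → InIdeal n q y
    from (divides r y≡rq) = r , (begin
      toℕ y       ≡⟨ m<n⇒m%n≡m (toℕ<n y) ⟨
      toℕ y % n   ≡⟨ cong (_% n) y≡rq ⟩
      (r * q) % n ≡⟨ cong (_% n) (*-comm r q) ⟩
      (q * r) % n ∎)
      where open ≡-Reasoning

  q*d≡n⇒n∣y*d⇒q∣y : ∀ {q d y} → q * d ≡ n → n ∣ y * d → q ∣ y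
  q*d≡n⇒n∣y*d⇒q∣y {q} {zero} qd≡n _ = ⊥-elim (0≢1+n (trans (sym (*-zeroʳ q)) qd≡n))
  q*d≡n⇒n∣y*d⇒q∣y {q} {d@(suc _)} {y} qd≡n n∣yd = *-cancelʳ-∣ d (subst (_∣ y * d) (sym qd≡n) n∣yd)

  gcd-1 : Fin n → Fin n → ℕ
  gcd-1 a b = gcd (gcd ∣ toℕ a -1∣ ∣ toℕ b -1∣) n

  gcd-1∣ˡ : ∀ a b → gcd-1 a b ∣ ∣ toℕ a -1∣
  gcd-1∣ˡ a b = ∣-trans (gcd[m,n]∣m _ n) (gcd[m,n]∣m ∣ toℕ a -1∣ ∣ toℕ b -1∣)

  gcd-1∣ʳ : ∀ a b → gcd-1 a b ∣ ∣ toℕ b -1∣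
  gcd-1∣ʳ a b = ∣-trans (gcd[m,n]∣m _ n) (gcd[m,n]∣n ∣ toℕ a -1∣ ∣ toℕ b -1∣)

  lowerBound⇔∈ideal : ∀ a b q {y} → Incomparable n a b → q * gcd-1 a b ≡ n →
                      (Leq n y a × Leq n y b) ⇔ InIdeal n q y
  lowerBound⇔∈ideal a b q {y} (a⋠b , b⋠a) qd≡n =
    mk⇔ (λ lb → Equivalence.from ∈ideal (lowerBound⇒q∣y lb))
        (λ y∈ → q∣y⇒lowerBound (Equivalence.to ∈ideal y∈))
    where
    ∈ideal : InIdeal n q y ⇔ (q ∣ toℕ y)
    ∈ideal = ∈ideal⇔∣ (divides (gcd-1 a b) (trans (sym qd≡n) (*-comm q _)))

    lowerBound⇒q∣y : Leq n y a × Leq n y b → q ∣ toℕ y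
    lowerBound⇒q∣y (y≼a , y≼b) = q*d≡n⇒n∣y*d⇒q∣y qd≡n n∣y*d
      where
      y≢a : y ≢ a
      y≢a refl = a⋠b y≼b
      y≢b : y ≢ b
      y≢b refl = b⋠a y≼a
      n∣y*d : n ∣ toℕ y * gcd-1 a b
      n∣y*d = ∣*m∣*n⇒∣*gcd (toℕ y) (gcd ∣ toℕ a -1∣ ∣ toℕ b -1∣) n
        (∣*m∣*n⇒∣*gcd (toℕ y) ∣ toℕ a -1∣ ∣ toℕ b -1∣ (≼⇒∣ y≼a y≢a) (≼⇒∣ y≼b y≢b))
        (n∣m*n (toℕ y))

    q∣y⇒lowerBound : q ∣ toℕ y → Leq n y a × Leq n y b
    q∣y⇒lowerBound q∣y = ∣⇒≼ (below (gcd-1∣ˡ a b)) , ∣⇒≼ (below (gcd-1∣ʳ a b))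
      where
      below : ∀ {t} → gcd-1 a b ∣ t → n ∣ toℕ y * t
      below {t} d∣t = subst (_∣ toℕ y * t) qd≡n (*-pres-∣ q∣y d∣t)

  meet⇔largest : ∀ a b q {c} → Incomparable n a b → q * gcd-1 a b ≡ n →
                 IsMeet n a b c ⇔ (InIdeal n q c × (∀ y → InIdeal n q y → Leq n y c))
  meet⇔largest a b q a∥b qd≡n = mk⇔
    (λ (c-lb , c-glb) → Equivalence.to lb⇔ c-lb , λ y y∈ → uncurry (c-glb y) (Equivalence.from lb⇔ y∈))
    (λ (c∈ , largest) → Equivalence.from lb⇔ c∈ , λ l l≼a l≼b → largest l (Equivalence.to lb⇔ (l≼a , l≼b)))
    where
    lb⇔ : ∀ {y} → (Leq n y a × Leq n y b) ⇔ InIdeal n q y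
    lb⇔ = lowerBound⇔∈ideal a b q a∥b qd≡n

module Characterisation (k : ℕ) where

  open Order (suc k)

  IdealsHaveLargest : Set
  IdealsHaveLargest = ∀ d → InS' n d → ∀ q → q * d ≡ n → HasLargest n q

  one : Fin n
  one = Fin.suc Fin.zero

  ≼-one : ∀ y → Leq n y one
  ≼-one y = inj₂ (sym (trans (cong (_% n) (*-identityʳ (toℕ y))) (m<n⇒m%n≡m (toℕ<n y))))

  meet⇒largest : IsLattice n → IdealsHaveLargest
  meet⇒largest lattice d (a , b , a∥b , +d≡gcd) q qd≡n with proj₂ (lattice a b)
  ... | c , c-meet = c , Equivalence.to (meet⇔largest a b q a∥b qd'≡n) c-meet
    where
    qd'≡n : q * gcd-1 a b ≡ n
    qd'≡n = subst (λ t → q * t ≡ n) (cong ℤ.∣_∣ +d≡gcd) qd≡n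

  largest⇒meet : IdealsHaveLargest → ∀ a b → ∃ λ c → IsMeet n a b c
  largest⇒meet H a b with a ≼? b | b ≼? a
  ... | yes a≼b | _       = a , (inj₁ refl , a≼b) , λ _ l≼a _ → l≼a
  ... | no _    | yes b≼a = b , (b≼a , inj₁ refl) , λ _ _ l≼b → l≼b
  ... | no a⋠b  | no b⋠a  with gcd[m,n]∣n (gcd ∣ toℕ a -1∣ ∣ toℕ b -1∣) n
  ...   | divides q n≡qd with H (gcd-1 a b) (a , b , (a⋠b , b⋠a) , refl) q (sym n≡qd)
  ...     | c , c-largest = c , Equivalence.from (meet⇔largest a b q (a⋠b , b⋠a) (sym n≡qd)) c-largest

  largest⇒lattice : IdealsHaveLargest → IsLattice n
  largest⇒lattice H a b = FiniteJoins.join (Leq n) ≼-trans _≼?_ one ≼-one (largest⇒meet H) a b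
                        , largest⇒meet H a b

corollary3p4 : (n : ℕ) → 1 < n →
    (IsLattice n → (∀ d → InS' n d → ∀ q → q * d ≡ n → HasLargest n q))
    × ((∀ d → InS' n d → ∀ q → q * d ≡ n → HasLargest n q) → IsLattice n)
corollary3p4 (suc (suc k)) (s≤s (s≤s _)) = meet⇒largest , largest⇒lattice
  where open Characterisation k
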